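{- Let $t$ be a closed $\rhd\beta_v$-normalizable term. Then for every derivation $\pi$ with conclusion $\vdash t\colon\mathbf{0}$ (empty environment) and every reduction sequence from $t$ to its $\rhd\beta_v$-normal form by $\rhd\beta_v$-steps, the number of steps of that sequence equals $|\pi|$.
   Context: Terms: $t ::= x \mid \lambda x.t \mid tu$ (up to $\alpha$); values $v ::= x \mid \lambda x.t$; closed means no free variables; $t\{v/x\}$ substitution. Root step ($\beta_v$): $(\lambda x.t)v \mapsto t\{v/x\}$ with $v$ a value. Balanced contexts $B ::= [\cdot] \mid (\lambda x.B)t \mid Bt \mid tB$; $\rhd\beta_v$-reduction is the closure of the root step under balanced contexts. Types: positive types are finite multisets $[(P_1,Q_1),\dots,(P_n,Q_n)]$ of pairs of positive types ($\mathbf{0}$ empty, $\uplus$ union). Environments map variables to positive types (finitely many non-$\mathbf{0}$), combined pointwise by $\uplus$. Rules: (ax) $x\colon P\vdash x\colon P$; ($\lambda$) from $\Gamma_i,x\colon P_i\vdash t\colon Q_i$ ($1\le i\le n$, $n\ge0$) infer $\biguplus_i\Gamma_i\vdash\lambda x.t\colon[(P_1,Q_1),\dots,(P_n,Q_n)]$; ($@$) from $\Gamma\vdash t\colon[(P,Q)]$ and $\Delta\vdash u\colon P$ infer $\Gamma\uplus\Delta\vdash tu\colon Q$. The size $|\pi|$ of a derivation is the number of $@$ rules in it. -}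

module Defs where

open import Data.Nat using (ℕ; zero; suc; _+_)
open import Data.Fin using (Fin; zero; suc; _≟_)
open import Data.List using (List; []; _∷_; _++_)
open import Data.Product using (_×_; _,_; Σ; ∃)
open import Relation.Nullary using (¬_; yes; no)

-- Terms (de Bruijn indices, so α-equivalence is syntactic equality).
-- Term n = terms with free variables among Fin n; closed terms = Term 0.

data Term (n : ℕ) : Set where
  var : Fin n → Term n
  ƛ   : Term (suc n) → Term n
  _·_ : Term n → Term n → Term n

infixl 7 _·_

data IsValue {n : ℕ} : Term n → Set where
  var : (x : Fin n) → IsValue (var x)
  ƛ   : (t : Term (suc n)) → IsValue (ƛ t)

Ren : ℕ → ℕ → Set
Ren n m = Fin n → Fin m

Sub : ℕ → ℕ → Set
Sub n m = Fin n → Term m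

extR : ∀ {n m} → Ren n m → Ren (suc n) (suc m)
extR ρ zero    = zero
extR ρ (suc i) = suc (ρ i)

rename : ∀ {n m} → Ren n m → Term n → Term m
rename ρ (var x) = var (ρ x)
rename ρ (ƛ t)   = ƛ (rename (extR ρ) t)
rename ρ (t · u) = rename ρ t · rename ρ u

extS : ∀ {n m} → Sub n m → Sub (suc n) (suc m)
extS σ zero    = var zero
extS σ (suc i) = rename suc (σ i)

subst : ∀ {n m} → Sub n m → Term n → Term m
subst σ (var x) = σ x
subst σ (ƛ t)   = ƛ (subst (extS σ) t)
subst σ (t · u) = subst σ t · subst σ u

-- t{v/x} where x is the variable bound by the enclosing λ (index 0)
_[_]₀ : ∀ {n} → Term (suc n) → Term n → Term n
t [ v ]₀ = subst σ t
  where
    σ : Sub _ _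
    σ zero    = v
    σ (suc i) = var i

-- ▷β_v reduction: the root step closed under balanced contexts
-- B ::= [·] | (λx.B)t | B t | t B

infix 4 _⟶_
data _⟶_ {n : ℕ} : Term n → Term n → Set where
  root : ∀ {t : Term (suc n)} {v : Term n} → IsValue v → (ƛ t) · v ⟶ t [ v ]₀
  lamL : ∀ {t t' : Term (suc n)} {u : Term n} → t ⟶ t' → (ƛ t) · u ⟶ (ƛ t') · u
  appL : ∀ {t t' u : Term n} → t ⟶ t' → t · u ⟶ t' · u
  appR : ∀ {t u u' : Term n} → u ⟶ u' → t · u ⟶ t · u'

data _⟶[_]_ {n : ℕ} : Term n → ℕ → Term n → Set where
  done : ∀ {t} → t ⟶[ zero ] t
  step : ∀ {t t' s k} → t ⟶ t' → t' ⟶[ k ] s → t ⟶[ suc k ] s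

Normal : ∀ {n} → Term n → Set
Normal t = ∀ t' → ¬ (t ⟶ t')

Normalizable : ∀ {n} → Term n → Set
Normalizable t = Σ _ λ s → Σ ℕ λ k → (t ⟶[ k ] s) × Normal s

-- Positive types: finite multisets of pairs of positive types,
-- represented by lists, identified up to (recursive) permutation _≈_.

data PType : Set where
  mset : List (PType × PType) → PType

𝟎 : PType
𝟎 = mset []

elems : PType → List (PType × PType)
elems (mset xs) = xs

_⊎ₜ_ : PType → PType → PType
P ⊎ₜ Q = mset (elems P ++ elems Q)

mutual
  data _≈_ : PType → PType → Set where
    mset : ∀ {xs ys} → Perm xs ys → mset xs ≈ mset ys

  data Perm : List (PType × PType) → List (PType × PType) → Set where
    []  : Perm [] []
    cons : ∀ {p q p' q' xs ys₁ ys₂} → p ≈ p' → q ≈ q' →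
           Perm xs (ys₁ ++ ys₂) →
           Perm ((p , q) ∷ xs) (ys₁ ++ ((p' , q') ∷ ys₂))

Env : ℕ → Set
Env n = Fin n → PType

0env : ∀ {n} → Env n
0env _ = 𝟎

_⊕_ : ∀ {n} → Env n → Env n → Env n
(Γ ⊕ Δ) i = Γ i ⊎ₜ Δ i

single : ∀ {n} → Fin n → PType → Env n
single x P y with y ≟ x
... | yes _ = P
... | no  _ = 𝟎

tailEnv : ∀ {n} → Env (suc n) → Env n
tailEnv Γ i = Γ (suc i)

infix 3 _⊢_∶_
mutual
  data _⊢_∶_ {n : ℕ} : Env n → Term n → PType → Set where
    ax  : (x : Fin n) (P : PType) → single x P ⊢ var x ∶ P
    lam : ∀ {Γ t ps} → Lams Γ t ps → Γ ⊢ ƛ t ∶ mset ps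
    app : ∀ {Γ Δ t u P P' Q} →
          Γ ⊢ t ∶ mset ((P , Q) ∷ []) → Δ ⊢ u ∶ P' → P' ≈ P →
          (Γ ⊕ Δ) ⊢ t · u ∶ Q

  -- the n ≥ 0 premises  Γᵢ, x : Pᵢ ⊢ t : Qᵢ  of the (λ) rule
  data Lams {n : ℕ} : Env n → Term (suc n) → List (PType × PType) → Set where
    nil  : ∀ {t} → Lams 0env t []
    cons : ∀ {Γ' : Env (suc n)} {Δ t Q ps} →
           Γ' ⊢ t ∶ Q → Lams Δ t ps →
           Lams (tailEnv Γ' ⊕ Δ) t ((Γ' zero , Q) ∷ ps)

mutual
  size : ∀ {n} {Γ : Env n} {t P} → Γ ⊢ t ∶ P → ℕ
  size (ax x P)      = zero
  size (lam ls)      = sizeL ls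
  size (app d e _)   = suc (size d + size e)

  sizeL : ∀ {n} {Γ : Env n} {t ps} → Lams Γ t ps → ℕ
  sizeL nil          = zero
  sizeL (cons d ls)  = size d + sizeL ls

-- Each ▷β_v-step of a typed term removes exactly one (@) rule from its derivation.  At a
-- root redex (λx.b)v the (@) rule and the (λ) rule meet; the (λ) rule has a single premise
-- typing b with x : P, and the derivation of v : P is substituted for the axioms on x.  As
-- v is a value, a derivation of v : P₁ ⊎ P₂ splits into derivations of v : P₁ and v : P₂
-- (a λ-abstraction by distributing the premises of its (λ) rule), and v : 𝟎 has a
-- derivation only of size 0; hence substituting v adds sizes and creates no (@) rule.  A
-- closed normal form is a value, so at type 𝟎 its derivation has size 0, and the length of
-- any normalising reduction sequence is the size of the initial derivation.
module Submission where

open import Defs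
open import Algebra.Bundles using (Monoid; CommutativeMonoid)
import Algebra.Construct.Pointwise as Pointwise
import Algebra.Properties.CommutativeMonoid.Sum as CommutativeMonoidSum
import Algebra.Properties.CommutativeSemigroup as CommutativeSemigroupProperties
import Algebra.Properties.Monoid.Sum as MonoidSum
open import Data.Empty using (⊥-elim)
open import Data.Fin using (Fin; zero; suc; _≟_)
open import Data.Fin.Properties using (suc-injective)
open import Data.List using (List; []; _∷_; _++_)
open import Data.List.Properties using (++-assoc; ++-identityʳ)
import Data.List.Relation.Binary.Pointwise as ListPointwise
open import Data.List.Relation.Ternary.Interleaving.Propositional as Interleaving
  using (Interleaving; []; consˡ; consʳ)
open import Data.List.Relation.Ternary.Interleaving.Properties using (++-disjoint)
open import Data.Nat using (ℕ; zero; suc; _+_)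
open import Data.Nat.Properties
  using (+-0-commutativeMonoid; +-commutativeSemigroup; +-assoc; +-identityʳ; +-suc)
open import Data.Product using (_×_; _,_; proj₁; proj₂; ∃-syntax)
open import Data.Vec.Functional using () renaming (_∷_ to _∷ₑ_)
open import Function using (_∘_; id)
open import Level using (0ℓ)
open import Relation.Binary.PropositionalEquality as ≡ using (_≡_; _≢_; refl; cong; cong₂)
import Relation.Binary.Reasoning.Setoid as SetoidReasoning
open import Relation.Nullary using (Dec; yes; no)

module SumSupport {a ℓ} (M : Monoid a ℓ) where
  open Monoid M renaming (_≈_ to _≈ᴹ_)
  open MonoidSum M

  sum-zero : ∀ {n} (f : Fin n → Carrier) → (∀ i → f i ≈ᴹ ε) → sum f ≈ᴹ ε
  sum-zero {n} f f≈ε = trans (sum-cong-≋ f≈ε) (sum-replicate-zero n)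

  sum-single : ∀ {n} (f : Fin n → Carrier) x → (∀ i → i ≢ x → f i ≈ᴹ ε) → sum f ≈ᴹ f x
  sum-single f zero    f≈ε =
    trans (∙-congˡ (sum-zero (f ∘ suc) (λ i → f≈ε (suc i) λ ()))) (identityʳ _)
  sum-single f (suc x) f≈ε =
    trans (∙-congʳ (f≈ε zero λ ()))
      (trans (identityˡ _) (sum-single (f ∘ suc) x (λ i i≢x → f≈ε (suc i) (i≢x ∘ suc-injective))))

-- Multisets of arrows

Arrow : Set
Arrow = PType × PType

-- Insertion-style permutations, as in _≈_, are awkward to compose; _↭_ has explicit swap
-- and transitivity constructors, and _≈_ embeds into it (≈⇒≃).
infix 4 _≃_ _↭_
mutual
  data _≃_ : PType → PType → Set where
    mset : ∀ {xs ys} → xs ↭ ys → mset xs ≃ mset ys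

  data _↭_ : List Arrow → List Arrow → Set where
    []    : [] ↭ []
    prep  : ∀ {p q p′ q′ xs ys} → p ≃ p′ → q ≃ q′ → xs ↭ ys → (p , q) ∷ xs ↭ (p′ , q′) ∷ ys
    swap  : ∀ a b xs → a ∷ b ∷ xs ↭ b ∷ a ∷ xs
    trans : ∀ {xs ys zs} → xs ↭ ys → ys ↭ zs → xs ↭ zs

mutual
  ≃-refl : ∀ {P} → P ≃ P
  ≃-refl {mset xs} = mset ↭-refl

  ↭-refl : ∀ {xs} → xs ↭ xs
  ↭-refl {[]}    = []
  ↭-refl {_ ∷ _} = prep ≃-refl ≃-refl ↭-refl

mutual
  ≃-sym : ∀ {P Q} → P ≃ Q → Q ≃ P
  ≃-sym (mset e) = mset (↭-sym e)

  ↭-sym : ∀ {xs ys} → xs ↭ ys → ys ↭ xs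
  ↭-sym []           = []
  ↭-sym (prep p q e) = prep (≃-sym p) (≃-sym q) (↭-sym e)
  ↭-sym (swap a b _) = swap b a _
  ↭-sym (trans e f)  = trans (↭-sym f) (↭-sym e)

≃-trans : ∀ {P Q R} → P ≃ Q → Q ≃ R → P ≃ R
≃-trans (mset e) (mset f) = mset (trans e f)

≡⇒↭ : ∀ {xs ys} → xs ≡ ys → xs ↭ ys
≡⇒↭ refl = ↭-refl

↭-++ˡ : ∀ zs {xs ys} → xs ↭ ys → zs ++ xs ↭ zs ++ ys
↭-++ˡ []       e = e
↭-++ˡ (_ ∷ zs) e = prep ≃-refl ≃-refl (↭-++ˡ zs e)

↭-++ : ∀ {xs xs′ ys ys′} → xs ↭ xs′ → ys ↭ ys′ → xs ++ ys ↭ xs′ ++ ys′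
↭-++ []            f = f
↭-++ (prep p q e)  f = prep p q (↭-++ e f)
↭-++ (swap a b xs) f = trans (swap a b _) (↭-++ˡ (b ∷ a ∷ xs) f)
↭-++ (trans e₁ e₂) f = trans (↭-++ e₁ f) (↭-++ e₂ ↭-refl)

↭-shift : ∀ a xs ys → a ∷ xs ++ ys ↭ xs ++ a ∷ ys
↭-shift a []       ys = ↭-refl
↭-shift a (x ∷ xs) ys = trans (swap a x _) (prep ≃-refl ≃-refl (↭-shift a xs ys))

↭-++-comm : ∀ xs ys → xs ++ ys ↭ ys ++ xs
↭-++-comm []       ys = ≡⇒↭ (≡.sym (++-identityʳ ys))
↭-++-comm (x ∷ xs) ys = trans (prep ≃-refl ≃-refl (↭-++-comm xs ys)) (↭-shift x ys xs)

[]↭⇒≡[] : ∀ {ys} → [] ↭ ys → ys ≡ []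
[]↭⇒≡[] []          = refl
[]↭⇒≡[] (trans e f) with []↭⇒≡[] e
... | refl = []↭⇒≡[] f

[-]↭⇒≡[-] : ∀ {P Q ys} → (P , Q) ∷ [] ↭ ys →
            ∃[ P′ ] ∃[ Q′ ] ys ≡ (P′ , Q′) ∷ [] × P ≃ P′ × Q ≃ Q′
[-]↭⇒≡[-] (prep p q e) with []↭⇒≡[] e
... | refl = _ , _ , refl , p , q
[-]↭⇒≡[-] (trans e f) with [-]↭⇒≡[-] e
... | _ , _ , refl , p , q with [-]↭⇒≡[-] f
...   | _ , _ , eq , p′ , q′ = _ , _ , eq , ≃-trans p p′ , ≃-trans q q′

mutual
  ≈⇒≃ : ∀ {P Q} → P ≈ Q → P ≃ Q
  ≈⇒≃ (mset p) = mset (Perm⇒↭ p)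

  Perm⇒↭ : ∀ {xs ys} → Perm xs ys → xs ↭ ys
  Perm⇒↭ []                                  = []
  Perm⇒↭ (cons {ys₁ = ys₁} {ys₂ = ys₂} p q e) =
    trans (prep (≈⇒≃ p) (≈⇒≃ q) (Perm⇒↭ e)) (↭-shift _ ys₁ ys₂)

interleaving-++ : ∀ {A : Set} (xs ys : List A) → Interleaving xs ys (xs ++ ys)
interleaving-++ xs ys =
  ++-disjoint (Interleaving.left (ListPointwise.refl refl)) (Interleaving.right (ListPointwise.refl refl))

↭-interleaving : ∀ {zs ws xs ys} → zs ↭ ws → Interleaving xs ys zs →
                 ∃[ xs′ ] ∃[ ys′ ] Interleaving xs′ ys′ ws × xs ↭ xs′ × ys ↭ ys′
↭-interleaving [] [] = _ , _ , [] , [] , []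
↭-interleaving (prep p q e) (consˡ i) with ↭-interleaving e i
... | _ , _ , i′ , xs↭ , ys↭ = _ , _ , consˡ i′ , prep p q xs↭ , ys↭
↭-interleaving (prep p q e) (consʳ i) with ↭-interleaving e i
... | _ , _ , i′ , xs↭ , ys↭ = _ , _ , consʳ i′ , xs↭ , prep p q ys↭
↭-interleaving (swap a b _) (consˡ (consˡ i)) = _ , _ , consˡ (consˡ i) , swap a b _ , ↭-refl
↭-interleaving (swap a b _) (consˡ (consʳ i)) = _ , _ , consʳ (consˡ i) , ↭-refl , ↭-refl
↭-interleaving (swap a b _) (consʳ (consˡ i)) = _ , _ , consˡ (consʳ i) , ↭-refl , ↭-refl
↭-interleaving (swap a b _) (consʳ (consʳ i)) = _ , _ , consʳ (consʳ i) , ↭-refl , swap a b _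
↭-interleaving (trans e f) i with ↭-interleaving e i
... | _ , _ , i′ , xs↭ , ys↭ with ↭-interleaving f i′
... | _ , _ , i″ , xs↭′ , ys↭′ = _ , _ , i″ , trans xs↭ xs↭′ , trans ys↭ ys↭′

-- Environments

⊎ₜ-commutativeMonoid : CommutativeMonoid 0ℓ 0ℓ
⊎ₜ-commutativeMonoid = record
  { Carrier             = PType
  ; _≈_                 = _≃_
  ; _∙_                 = _⊎ₜ_
  ; ε                   = 𝟎
  ; isCommutativeMonoid = record
    { isMonoid = record
      { isSemigroup = record
        { isMagma = record
          { isEquivalence = record { refl = ≃-refl ; sym = ≃-sym ; trans = ≃-trans }
          ; ∙-cong        = λ { (mset e) (mset f) → mset (↭-++ e f) } }
        ; assoc = λ { (mset xs) (mset ys) (mset zs) → mset (≡⇒↭ (++-assoc xs ys zs)) } }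
      ; identity = (λ { (mset _) → ≃-refl }) , λ { (mset xs) → mset (≡⇒↭ (++-identityʳ xs)) } }
    ; comm = λ { (mset xs) (mset ys) → mset (↭-++-comm xs ys) } } }

-- Its operation and unit are definitionally _⊕_ and 0env.
Env-commutativeMonoid : ℕ → CommutativeMonoid 0ℓ 0ℓ
Env-commutativeMonoid n = Pointwise.commutativeMonoid (Fin n) ⊎ₜ-commutativeMonoid

module ⊎ₜ = CommutativeMonoid ⊎ₜ-commutativeMonoid
module Envₘ {n : ℕ} = CommutativeMonoid (Env-commutativeMonoid n)
module Envₚ {n : ℕ} = CommutativeSemigroupProperties (Envₘ.commutativeSemigroup {n})
module ℕₚ = CommutativeSemigroupProperties +-commutativeSemigroup
module ≃-Reasoning = SetoidReasoning ⊎ₜ.setoid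

infix 4 _≈ₑ_
_≈ₑ_ : ∀ {n} → Env n → Env n → Set
_≈ₑ_ = Envₘ._≈_

⊕-congˡ : ∀ {n} (Γ : Env n) {Δ Δ′} → Δ ≈ₑ Δ′ → Γ ⊕ Δ ≈ₑ Γ ⊕ Δ′
⊕-congˡ Γ = Envₘ.∙-congˡ {x = Γ}

⊕-congʳ : ∀ {n} (Δ : Env n) {Γ Γ′} → Γ ≈ₑ Γ′ → Γ ⊕ Δ ≈ₑ Γ′ ⊕ Δ
⊕-congʳ Δ = Envₘ.∙-congʳ {x = Δ}

module ∑ₜ where
  open CommutativeMonoidSum ⊎ₜ-commutativeMonoid public
  open SumSupport ⊎ₜ.monoid public

module ∑ₑ {m : ℕ} where
  open CommutativeMonoidSum (Env-commutativeMonoid m) public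
  open SumSupport (Envₘ.monoid {m}) public

module ∑ₙ where
  open CommutativeMonoidSum +-0-commutativeMonoid public
  open SumSupport (CommutativeMonoid.monoid +-0-commutativeMonoid) public

∑ₑ-apply : ∀ {n m} (F : Fin n → Env m) y → ∑ₑ.sum F y ≡ ∑ₜ.sum (λ i → F i y)
∑ₑ-apply {zero}  F y = refl
∑ₑ-apply {suc n} F y = cong (F zero y ⊎ₜ_) (∑ₑ-apply (F ∘ suc) y)

single-self : ∀ {n} (x : Fin n) P → single x P x ≡ P
single-self x P with x ≟ x
... | yes _  = refl
... | no x≢x = ⊥-elim (x≢x refl)

single-other : ∀ {n} {x y : Fin n} P → y ≢ x → single x P y ≡ 𝟎
single-other {x = x} {y} P y≢x with y ≟ x
... | yes y≡x = ⊥-elim (y≢x y≡x)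
... | no _    = refl

single-suc : ∀ {n} (x y : Fin n) P → single (suc x) P (suc y) ≡ single x P y
single-suc x y P = by-cases (y ≟ x)
  where
    by-cases : Dec (y ≡ x) → single (suc x) P (suc y) ≡ single x P y
    by-cases (yes refl) = ≡.trans (single-self (suc x) P) (≡.sym (single-self x P))
    by-cases (no y≢x)   = ≡.trans (single-other P (y≢x ∘ suc-injective)) (≡.sym (single-other P y≢x))

single-cong : ∀ {n} (x : Fin n) {P Q} → P ≃ Q → single x P ≈ₑ single x Q
single-cong x P≃Q y with y ≟ x
... | yes _ = P≃Q
... | no _  = ≃-refl

single-⊎ₜ : ∀ {n} (x : Fin n) P Q → single x (P ⊎ₜ Q) ≈ₑ single x P ⊕ single x Q
single-⊎ₜ x P Q y with y ≟ x
... | yes _ = ≃-refl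
... | no _  = ≃-refl

single-𝟎 : ∀ {n} (x : Fin n) {P} → P ≃ 𝟎 → single x P ≈ₑ 0env
single-𝟎 x P≃𝟎 y with y ≟ x
... | yes _ = P≃𝟎
... | no _  = ≃-refl

renameEnv : ∀ {n m} → Ren n m → Env n → Env m
renameEnv ρ Γ = ∑ₑ.sum (λ i → single (ρ i) (Γ i))

module _ {n m : ℕ} (ρ : Ren n m) where

  renameEnv-cong : ∀ {Γ Δ} → Γ ≈ₑ Δ → renameEnv ρ Γ ≈ₑ renameEnv ρ Δ
  renameEnv-cong Γ≈Δ = ∑ₑ.sum-cong-≋ (λ i → single-cong (ρ i) (Γ≈Δ i))

  renameEnv-⊕ : ∀ Γ Δ → renameEnv ρ (Γ ⊕ Δ) ≈ₑ renameEnv ρ Γ ⊕ renameEnv ρ Δ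
  renameEnv-⊕ Γ Δ = Envₘ.trans (∑ₑ.sum-cong-≋ (λ i → single-⊎ₜ (ρ i) (Γ i) (Δ i)))
                               (∑ₑ.∑-distrib-+ (λ i → single (ρ i) (Γ i)) (λ i → single (ρ i) (Δ i)))

  renameEnv-0env : renameEnv ρ 0env ≈ₑ 0env
  renameEnv-0env = ∑ₑ.sum-zero (λ i → single (ρ i) 𝟎) (λ i → single-𝟎 (ρ i) ≃-refl)

  renameEnv-single : ∀ x P → renameEnv ρ (single x P) ≈ₑ single (ρ x) P
  renameEnv-single x P = Envₘ.trans
    (∑ₑ.sum-single (λ i → single (ρ i) (single x P i)) x
                   (λ i i≢x → single-𝟎 (ρ i) (⊎ₜ.reflexive (single-other P i≢x))))
    (single-cong (ρ x) (⊎ₜ.reflexive (single-self x P)))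

  renameEnv-suc∘-zero : ∀ Γ → renameEnv (λ i → suc (ρ i)) Γ zero ≃ 𝟎
  renameEnv-suc∘-zero Γ = ⊎ₜ.trans (⊎ₜ.reflexive (∑ₑ-apply (λ i → single (suc (ρ i)) (Γ i)) zero))
                                   (∑ₜ.sum-zero (λ i → single (suc (ρ i)) (Γ i) zero) (λ _ → ≃-refl))

  renameEnv-suc∘-suc : ∀ Γ y → renameEnv (λ i → suc (ρ i)) Γ (suc y) ≡ renameEnv ρ Γ y
  renameEnv-suc∘-suc Γ y = begin
    renameEnv (λ i → suc (ρ i)) Γ (suc y)            ≡⟨ ∑ₑ-apply (λ i → single (suc (ρ i)) (Γ i)) (suc y) ⟩
    ∑ₜ.sum (λ i → single (suc (ρ i)) (Γ i) (suc y))  ≡⟨ ∑ₜ.sum-cong-≗ (λ i → single-suc (ρ i) y (Γ i)) ⟩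
    ∑ₜ.sum (λ i → single (ρ i) (Γ i) y)              ≡⟨ ∑ₑ-apply (λ i → single (ρ i) (Γ i)) y ⟨
    renameEnv ρ Γ y                                  ∎
    where open ≡.≡-Reasoning

  renameEnv-ext : ∀ Γ → renameEnv (extR ρ) Γ ≈ₑ Γ zero ∷ₑ renameEnv ρ (tailEnv Γ)
  renameEnv-ext Γ zero    =
    ⊎ₜ.trans (⊎ₜ.∙-congˡ {Γ zero} (renameEnv-suc∘-zero (tailEnv Γ))) (⊎ₜ.identityʳ (Γ zero))
  renameEnv-ext Γ (suc y) =
    ⊎ₜ.trans (⊎ₜ.identityˡ _) (⊎ₜ.reflexive (renameEnv-suc∘-suc (tailEnv Γ) y))

renameEnv-id : ∀ {n} (Γ : Env n) → renameEnv id Γ ≈ₑ Γ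
renameEnv-id Γ y = begin
  renameEnv id Γ y                ≡⟨ ∑ₑ-apply (λ i → single i (Γ i)) y ⟩
  ∑ₜ.sum (λ i → single i (Γ i) y) ≈⟨ ∑ₜ.sum-single (λ i → single i (Γ i) y) y
                                       (λ i i≢y → ⊎ₜ.reflexive (single-other (Γ i) (i≢y ∘ ≡.sym))) ⟩
  single y (Γ y) y                ≡⟨ single-self y (Γ y) ⟩
  Γ y                             ∎
  where open ≃-Reasoning

renameEnv-suc : ∀ {n} (Γ : Env n) → renameEnv suc Γ ≈ₑ 𝟎 ∷ₑ Γ
renameEnv-suc Γ zero    = renameEnv-suc∘-zero id Γ
renameEnv-suc Γ (suc y) = ⊎ₜ.trans (⊎ₜ.reflexive (renameEnv-suc∘-suc id Γ y)) (renameEnv-id Γ y)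

∑ₑ-weaken : ∀ {n m} P (F : Fin n → Env m) →
            single zero P ⊕ ∑ₑ.sum (λ i → renameEnv suc (F i)) ≈ₑ P ∷ₑ ∑ₑ.sum F
∑ₑ-weaken {n} {m} P F zero = begin
  P ⊎ₜ ∑ₑ.sum F′ zero            ≡⟨ cong (P ⊎ₜ_) (∑ₑ-apply F′ zero) ⟩
  P ⊎ₜ ∑ₜ.sum (λ i → F′ i zero)  ≈⟨ ⊎ₜ.∙-congˡ {P} (∑ₜ.sum-zero _ (λ i → renameEnv-suc (F i) zero)) ⟩
  P ⊎ₜ 𝟎                         ≈⟨ ⊎ₜ.identityʳ P ⟩
  P                              ∎
  where
    F′ : Fin n → Env (suc m)
    F′ i = renameEnv suc (F i)
    open ≃-Reasoning
∑ₑ-weaken {n} {m} P F (suc y) = begin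
  𝟎 ⊎ₜ ∑ₑ.sum F′ (suc y)         ≈⟨ ⊎ₜ.identityˡ _ ⟩
  ∑ₑ.sum F′ (suc y)              ≡⟨ ∑ₑ-apply F′ (suc y) ⟩
  ∑ₜ.sum (λ i → F′ i (suc y))    ≈⟨ ∑ₜ.sum-cong-≋ (λ i → renameEnv-suc (F i) (suc y)) ⟩
  ∑ₜ.sum (λ i → F i y)           ≡⟨ ∑ₑ-apply F y ⟨
  ∑ₑ.sum F y                     ∎
  where
    F′ : Fin n → Env (suc m)
    F′ i = renameEnv suc (F i)
    open ≃-Reasoning

-- Sized derivations up to equivalence

-- Derivations indexed by their size and closed under ≃ and ≈ₑ by the size-preserving rule
-- conv: substitution determines types and environments only up to these equivalences.
infix 3 _⊩_∶_#_ _⊩ƛ_∶_#_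
mutual
  data _⊩_∶_#_ {n : ℕ} : Env n → Term n → PType → ℕ → Set where
    ax   : ∀ x P → single x P ⊩ var x ∶ P # 0
    lam  : ∀ {Γ t ps k} → Γ ⊩ƛ t ∶ ps # k → Γ ⊩ ƛ t ∶ mset ps # k
    app  : ∀ {Γ Δ t u P P′ Q k₁ k₂} →
           Γ ⊩ t ∶ mset ((P , Q) ∷ []) # k₁ → Δ ⊩ u ∶ P′ # k₂ → P′ ≃ P →
           Γ ⊕ Δ ⊩ t · u ∶ Q # suc (k₁ + k₂)
    conv : ∀ {Γ Γ′ t P P′ k} → Γ ⊩ t ∶ P # k → Γ′ ≈ₑ Γ → P′ ≃ P → Γ′ ⊩ t ∶ P′ # k

  data _⊩ƛ_∶_#_ {n : ℕ} : Env n → Term (suc n) → List Arrow → ℕ → Set where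
    []  : ∀ {t} → 0env ⊩ƛ t ∶ [] # 0
    _∷_ : ∀ {Γ Δ t Q ps k₁ k₂} → Γ ⊩ t ∶ Q # k₁ → Δ ⊩ƛ t ∶ ps # k₂ →
          tailEnv Γ ⊕ Δ ⊩ƛ t ∶ (Γ zero , Q) ∷ ps # k₁ + k₂

resize : ∀ {n} {Γ : Env n} {t P k k′} → k ≡ k′ → Γ ⊩ t ∶ P # k → Γ ⊩ t ∶ P # k′
resize refl d = d

resizeƛ : ∀ {n} {Γ : Env n} {t ps k k′} → k ≡ k′ → Γ ⊩ƛ t ∶ ps # k → Γ ⊩ƛ t ∶ ps # k′
resizeƛ refl ds = ds

mutual
  ⊢⇒⊩ : ∀ {n} {Γ : Env n} {t P} (π : Γ ⊢ t ∶ P) → Γ ⊩ t ∶ P # size π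
  ⊢⇒⊩ (ax x P)     = ax x P
  ⊢⇒⊩ (lam πs)     = lam (Lams⇒⊩ƛ πs)
  ⊢⇒⊩ (app π ρ P≈) = app (⊢⇒⊩ π) (⊢⇒⊩ ρ) (≈⇒≃ P≈)

  Lams⇒⊩ƛ : ∀ {n} {Γ : Env n} {t ps} (πs : Lams Γ t ps) → Γ ⊩ƛ t ∶ ps # sizeL πs
  Lams⇒⊩ƛ nil         = []
  Lams⇒⊩ƛ (cons π πs) = ⊢⇒⊩ π ∷ Lams⇒⊩ƛ πs

⊩-var-inv : ∀ {n} {Γ : Env n} {x T k} → Γ ⊩ var x ∶ T # k →
            ∃[ P ] Γ ≈ₑ single x P × T ≃ P × k ≡ 0
⊩-var-inv (ax x P)       = P , Envₘ.refl , ≃-refl , refl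
⊩-var-inv (conv d Γ≈ T≃) with ⊩-var-inv d
... | P , Γ≈′ , T≃′ , k≡0 = P , Envₘ.trans Γ≈ Γ≈′ , ≃-trans T≃ T≃′ , k≡0

⊩-ƛ-inv : ∀ {n} {Γ : Env n} {t T k} → Γ ⊩ ƛ t ∶ T # k →
          ∃[ Γ₀ ] ∃[ ps ] Γ₀ ⊩ƛ t ∶ ps # k × Γ ≈ₑ Γ₀ × T ≃ mset ps
⊩-ƛ-inv (lam ds)       = _ , _ , ds , Envₘ.refl , ≃-refl
⊩-ƛ-inv (conv d Γ≈ T≃) with ⊩-ƛ-inv d
... | Γ₀ , ps , ds , Γ≈′ , T≃′ = Γ₀ , ps , ds , Envₘ.trans Γ≈ Γ≈′ , ≃-trans T≃ T≃′

record ·-Inversion {n} (Γ : Env n) (t u : Term n) (Q : PType) (k : ℕ) : Set where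
  constructor ·-inv
  field
    {Γ₁ Δ}   : Env n
    {P}      : PType
    {k₁ k₂}  : ℕ
    function : Γ₁ ⊩ t ∶ mset ((P , Q) ∷ []) # k₁
    argument : Δ ⊩ u ∶ P # k₂
    env-≈    : Γ ≈ₑ Γ₁ ⊕ Δ
    size-≡   : k ≡ suc (k₁ + k₂)

⊩-·-inv : ∀ {n} {Γ : Env n} {t u Q k} → Γ ⊩ t · u ∶ Q # k → ·-Inversion Γ t u Q k
⊩-·-inv (app d e P′≃P) = ·-inv d (conv e Envₘ.refl (≃-sym P′≃P)) Envₘ.refl refl
⊩-·-inv (conv d Γ≈ Q≃) with ⊩-·-inv d
... | ·-inv f a Γ≈′ k≡ = ·-inv (conv f Envₘ.refl (mset (prep ≃-refl Q≃ []))) a (Envₘ.trans Γ≈ Γ≈′) k≡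

record β-Inversion {n} (Γ : Env n) (b : Term (suc n)) (u : Term n) (Q : PType) (k : ℕ) : Set where
  constructor β-inv
  field
    {Γ′}     : Env (suc n)
    {Δ}      : Env n
    {k₁ k₂}  : ℕ
    body     : Γ′ ⊩ b ∶ Q # k₁
    argument : Δ ⊩ u ∶ Γ′ zero # k₂
    env-≈    : Γ ≈ₑ tailEnv Γ′ ⊕ Δ
    size-≡   : k ≡ suc (k₁ + k₂)

⊩-β-inv : ∀ {n} {Γ : Env n} {b u Q k} → Γ ⊩ ƛ b · u ∶ Q # k → β-Inversion Γ b u Q k
⊩-β-inv d with ⊩-·-inv d
... | ·-inv {Δ = Δ} f a Γ≈ k≡ with ⊩-ƛ-inv f
... | _ , _ , ds , Γ₁≈ , mset [PQ]↭ps with [-]↭⇒≡[-] [PQ]↭ps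
... | _ , _ , refl , P≃ , Q≃ with ds
... | _∷_ {Γ = Γ′} {k₁ = k₁} d [] =
  β-inv (conv d Envₘ.refl Q≃) (conv a Envₘ.refl (≃-sym P≃))
        (Envₘ.trans Γ≈ (⊕-congʳ Δ (Envₘ.trans Γ₁≈ (Envₘ.identityʳ (tailEnv Γ′)))))
        (≡.trans k≡ (cong suc (cong (_+ _) (+-identityʳ k₁))))

mutual
  ⊩-rename : ∀ {n m} (ρ : Ren n m) {Γ t Q k} → Γ ⊩ t ∶ Q # k →
             renameEnv ρ Γ ⊩ rename ρ t ∶ Q # k
  ⊩-rename ρ (ax x P)                 = conv (ax (ρ x) P) (renameEnv-single ρ x P) ≃-refl
  ⊩-rename ρ (lam ds) with ⊩ƛ-rename ρ ds
  ... | _ , ds′ , Γ≈                  = conv (lam ds′) Γ≈ ≃-refl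
  ⊩-rename ρ (app {Γ = Γ} {Δ} d e P≃) =
    conv (app (⊩-rename ρ d) (⊩-rename ρ e) P≃) (renameEnv-⊕ ρ Γ Δ) ≃-refl
  ⊩-rename ρ (conv d Γ≈ T≃)           = conv (⊩-rename ρ d) (renameEnv-cong ρ Γ≈) T≃

  ⊩ƛ-rename : ∀ {n m} (ρ : Ren n m) {Γ t ps k} → Γ ⊩ƛ t ∶ ps # k →
              ∃[ Γ′ ] Γ′ ⊩ƛ rename (extR ρ) t ∶ ps # k × renameEnv ρ Γ ≈ₑ Γ′
  ⊩ƛ-rename ρ []                     = _ , [] , renameEnv-0env ρ
  ⊩ƛ-rename ρ (_∷_ {Γ = Γ} {Δ} d ds) with ⊩ƛ-rename ρ ds
  ... | _ , ds′ , Δ≈ =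
    _ , conv (⊩-rename (extR ρ) d) (Envₘ.sym (renameEnv-ext ρ Γ)) ≃-refl ∷ ds′ ,
    Envₘ.trans (renameEnv-⊕ ρ (tailEnv Γ) Δ) (⊕-congˡ (renameEnv ρ (tailEnv Γ)) Δ≈)

record Split {n} (J₁ J₂ : Env n → ℕ → Set) (Γ : Env n) (k : ℕ) : Set where
  constructor split
  field
    {Γ₁ Γ₂} : Env n
    {k₁ k₂} : ℕ
    left    : J₁ Γ₁ k₁
    right   : J₂ Γ₂ k₂
    env-≈   : Γ ≈ₑ Γ₁ ⊕ Γ₂
    size-≡  : k ≡ k₁ + k₂

⊩ƛ-split : ∀ {n} {Γ : Env n} {t ps xs ys k} → Γ ⊩ƛ t ∶ ps # k → Interleaving xs ys ps →
           Split (_⊩ƛ t ∶ xs #_) (_⊩ƛ t ∶ ys #_) Γ k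
⊩ƛ-split [] [] = split [] [] (Envₘ.sym (Envₘ.identityʳ 0env)) refl
⊩ƛ-split (_∷_ {Γ = Γ} {k₁ = k} d ds) (consˡ i) with ⊩ƛ-split ds i
... | split {Γ₁} {Γ₂} {k₁} {k₂} l r Δ≈ k≡ =
  split (d ∷ l) r (Envₘ.trans (⊕-congˡ (tailEnv Γ) Δ≈) (Envₘ.sym (Envₘ.assoc (tailEnv Γ) Γ₁ Γ₂)))
        (≡.trans (cong (k +_) k≡) (≡.sym (+-assoc k k₁ k₂)))
⊩ƛ-split (_∷_ {Γ = Γ} {k₁ = k} d ds) (consʳ i) with ⊩ƛ-split ds i
... | split {Γ₁} {Γ₂} {k₁} {k₂} l r Δ≈ k≡ =
  split l (d ∷ r) (Envₘ.trans (⊕-congˡ (tailEnv Γ) Δ≈) (Envₚ.x∙yz≈y∙xz (tailEnv Γ) Γ₁ Γ₂))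
        (≡.trans (cong (k +_) k≡) (ℕₚ.x∙yz≈y∙xz k k₁ k₂))

⊩-value-split : ∀ {n} {Δ : Env n} {v P Q k} → IsValue v → Δ ⊩ v ∶ P ⊎ₜ Q # k →
                Split (_⊩ v ∶ P #_) (_⊩ v ∶ Q #_) Δ k
⊩-value-split {P = P} {Q} (var x) d with ⊩-var-inv d
... | _ , Δ≈ , PQ≃ , k≡0 =
  split (ax x P) (ax x Q) (Envₘ.trans Δ≈ (Envₘ.trans (single-cong x (≃-sym PQ≃)) (single-⊎ₜ x P Q))) k≡0
⊩-value-split {P = mset xs} {mset ys} (ƛ t) d with ⊩-ƛ-inv d
... | _ , _ , ds , Δ≈ , mset ++↭ps with ↭-interleaving ++↭ps (interleaving-++ xs ys)
... | _ , _ , i , xs↭ , ys↭ with ⊩ƛ-split ds i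
... | split l r Γ₀≈ k≡ =
  split (conv (lam l) Envₘ.refl (mset xs↭)) (conv (lam r) Envₘ.refl (mset ys↭)) (Envₘ.trans Δ≈ Γ₀≈) k≡

⊩-value-𝟎 : ∀ {n} {Δ : Env n} {v k} → IsValue v → Δ ⊩ v ∶ 𝟎 # k → Δ ≈ₑ 0env × k ≡ 0
⊩-value-𝟎 (var x) d with ⊩-var-inv d
... | _ , Δ≈ , 𝟎≃ , k≡0 = Envₘ.trans Δ≈ (single-𝟎 x (≃-sym 𝟎≃)) , k≡0
⊩-value-𝟎 (ƛ t) d with ⊩-ƛ-inv d
... | _ , _ , ds , Δ≈ , mset []↭ps with []↭⇒≡[] []↭ps
⊩-value-𝟎 (ƛ t) d | _ , _ , [] , Δ≈ , _ | refl = Δ≈ , refl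

-- Substitution of values

infix 3 _⊩ˢ_∶_#_
record _⊩ˢ_∶_#_ {n m} (Δ : Env m) (σ : Sub n m) (Γ : Env n) (k : ℕ) : Set where
  constructor ⊩ˢ
  field
    envs   : Fin n → Env m
    sizes  : Fin n → ℕ
    derivs : ∀ i → envs i ⊩ σ i ∶ Γ i # sizes i
    env-≈  : Δ ≈ₑ ∑ₑ.sum envs
    size-≡ : k ≡ ∑ₙ.sum sizes

AllValues : ∀ {n m} → Sub n m → Set
AllValues σ = ∀ i → IsValue (σ i)

rename-value : ∀ {n m} (ρ : Ren n m) {v} → IsValue v → IsValue (rename ρ v)
rename-value ρ (var x) = var (ρ x)
rename-value ρ (ƛ t)   = ƛ _

extS-values : ∀ {n m} {σ : Sub n m} → AllValues σ → AllValues (extS σ)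
extS-values values zero    = var zero
extS-values values (suc i) = rename-value suc (values i)

⊩ˢ-conv : ∀ {n m} {Δ : Env m} {σ : Sub n m} {Γ Γ′ k} → Γ′ ≈ₑ Γ → Δ ⊩ˢ σ ∶ Γ # k → Δ ⊩ˢ σ ∶ Γ′ # k
⊩ˢ-conv Γ′≈Γ (⊩ˢ envs sizes derivs Δ≈ k≡) =
  ⊩ˢ envs sizes (λ i → conv (derivs i) Envₘ.refl (Γ′≈Γ i)) Δ≈ k≡

module _ {n m} {σ : Sub n m} (values : AllValues σ) where

  ⊩ˢ-split : ∀ {Δ Γ₁ Γ₂ k} → Δ ⊩ˢ σ ∶ Γ₁ ⊕ Γ₂ # k → Split (_⊩ˢ σ ∶ Γ₁ #_) (_⊩ˢ σ ∶ Γ₂ #_) Δ k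
  ⊩ˢ-split {Γ₁ = Γ₁} {Γ₂} (⊩ˢ envs sizes derivs Δ≈ k≡) =
    split (⊩ˢ envs₁ sizes₁ (Split.left ∘ splits) Envₘ.refl refl)
          (⊩ˢ envs₂ sizes₂ (Split.right ∘ splits) Envₘ.refl refl)
          (Envₘ.trans Δ≈ (Envₘ.trans (∑ₑ.sum-cong-≋ (Split.env-≈ ∘ splits)) (∑ₑ.∑-distrib-+ envs₁ envs₂)))
          (≡.trans k≡ (≡.trans (∑ₙ.sum-cong-≋ (Split.size-≡ ∘ splits)) (∑ₙ.∑-distrib-+ sizes₁ sizes₂)))
    where
      splits : ∀ i → Split (_⊩ σ i ∶ Γ₁ i #_) (_⊩ σ i ∶ Γ₂ i #_) (envs i) (sizes i)
      splits i = ⊩-value-split (values i) (derivs i)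
      envs₁ envs₂ : Fin n → Env m
      envs₁ = Split.Γ₁ ∘ splits
      envs₂ = Split.Γ₂ ∘ splits
      sizes₁ sizes₂ : Fin n → ℕ
      sizes₁ = Split.k₁ ∘ splits
      sizes₂ = Split.k₂ ∘ splits

  ⊩ˢ-0env : ∀ {Δ k} → Δ ⊩ˢ σ ∶ 0env # k → Δ ≈ₑ 0env × k ≡ 0
  ⊩ˢ-0env (⊩ˢ envs sizes derivs Δ≈ k≡) =
    Envₘ.trans Δ≈ (∑ₑ.sum-zero envs (proj₁ ∘ vanish)) , ≡.trans k≡ (∑ₙ.sum-zero sizes (proj₂ ∘ vanish))
    where
      vanish : ∀ i → envs i ≈ₑ 0env × sizes i ≡ 0
      vanish i = ⊩-value-𝟎 (values i) (derivs i)

  ⊩ˢ-single : ∀ {Δ x P k} → Δ ⊩ˢ σ ∶ single x P # k → Δ ⊩ σ x ∶ P # k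
  ⊩ˢ-single {x = x} {P} (⊩ˢ envs sizes derivs Δ≈ k≡) =
    resize (≡.sym (≡.trans k≡ (∑ₙ.sum-single sizes x (λ i → proj₂ ∘ vanish i))))
      (conv (derivs x) (Envₘ.trans Δ≈ (∑ₑ.sum-single envs x (λ i → proj₁ ∘ vanish i)))
            (⊎ₜ.reflexive (≡.sym (single-self x P))))
    where
      vanish : ∀ i → i ≢ x → envs i ≈ₑ 0env × sizes i ≡ 0
      vanish i i≢x =
        ⊩-value-𝟎 (values i) (conv (derivs i) Envₘ.refl (⊎ₜ.reflexive (≡.sym (single-other P i≢x))))

⊩ˢ-ext : ∀ {n m} {Δ : Env m} {σ : Sub n m} {Γ : Env (suc n)} {k} →
         Δ ⊩ˢ σ ∶ tailEnv Γ # k → Γ zero ∷ₑ Δ ⊩ˢ extS σ ∶ Γ # k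
⊩ˢ-ext {n} {m} {Δ} {σ} {Γ} (⊩ˢ envs sizes derivs Δ≈ k≡) = ⊩ˢ envs′ sizes′ derivs′ Δ′≈ k≡
  where
    envs′ : Fin (suc n) → Env (suc m)
    envs′ zero    = single zero (Γ zero)
    envs′ (suc i) = renameEnv suc (envs i)
    sizes′ : Fin (suc n) → ℕ
    sizes′ zero    = 0
    sizes′ (suc i) = sizes i
    derivs′ : ∀ i → envs′ i ⊩ extS σ i ∶ Γ i # sizes′ i
    derivs′ zero    = ax zero (Γ zero)
    derivs′ (suc i) = ⊩-rename suc (derivs i)
    Δ′≈ : Γ zero ∷ₑ Δ ≈ₑ ∑ₑ.sum envs′
    Δ′≈ = Envₘ.sym (Envₘ.trans (∑ₑ-weaken (Γ zero) envs) λ { zero → ≃-refl ; (suc y) → ≃-sym (Δ≈ y) })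

mutual
  ⊩-subst : ∀ {n m} {σ : Sub n m} → AllValues σ → ∀ {Γ Δ t Q k j} →
            Γ ⊩ t ∶ Q # k → Δ ⊩ˢ σ ∶ Γ # j → Δ ⊩ subst σ t ∶ Q # k + j
  ⊩-subst values (ax x P) θ = ⊩ˢ-single values θ
  ⊩-subst values (lam ds) θ with ⊩ƛ-subst values ds θ
  ... | _ , ds′ , Δ≈ = conv (lam ds′) Δ≈ ≃-refl
  ⊩-subst values (app {Γ = Γ₁} {Γ₂} {k₁ = k₁} {k₂} d e P≃) θ with ⊩ˢ-split values {Γ₁ = Γ₁} {Γ₂} θ
  ... | split {k₁ = j₁} {j₂} θ₁ θ₂ Δ≈ refl =
    resize (cong suc (ℕₚ.interchange k₁ j₁ k₂ j₂))
      (conv (app (⊩-subst values d θ₁) (⊩-subst values e θ₂) P≃) Δ≈ ≃-refl)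
  ⊩-subst values (conv d Γ≈ T≃) θ = conv (⊩-subst values d (⊩ˢ-conv (Envₘ.sym Γ≈) θ)) Envₘ.refl T≃

  ⊩ƛ-subst : ∀ {n m} {σ : Sub n m} → AllValues σ → ∀ {Γ Δ t ps k j} →
             Γ ⊩ƛ t ∶ ps # k → Δ ⊩ˢ σ ∶ Γ # j →
             ∃[ Δ′ ] Δ′ ⊩ƛ subst (extS σ) t ∶ ps # k + j × Δ ≈ₑ Δ′
  ⊩ƛ-subst values [] θ with ⊩ˢ-0env values θ
  ... | Δ≈ , refl = _ , [] , Δ≈
  ⊩ƛ-subst values (_∷_ {Γ = Γ} {Γ₂} {k₁ = k₁} {k₂} d ds) θ
    with ⊩ˢ-split values {Γ₁ = tailEnv Γ} {Γ₂} θ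
  ... | split {Γ₁} {k₁ = j₁} {j₂} θ₁ θ₂ Δ≈ refl with ⊩ƛ-subst values ds θ₂
  ... | _ , ds′ , Γ₂≈ =
    _ , resizeƛ (ℕₚ.interchange k₁ j₁ k₂ j₂) (⊩-subst (extS-values values) d (⊩ˢ-ext θ₁) ∷ ds′) ,
    Envₘ.trans Δ≈ (⊕-congˡ Γ₁ Γ₂≈)

subst-cong : ∀ {n m} {σ τ : Sub n m} → (∀ i → σ i ≡ τ i) → ∀ t → subst σ t ≡ subst τ t
subst-cong σ≡τ (var x) = σ≡τ x
subst-cong σ≡τ (ƛ t)   = cong ƛ (subst-cong (λ { zero → refl ; (suc i) → cong (rename suc) (σ≡τ i) }) t)
subst-cong σ≡τ (t · u) = cong₂ _·_ (subst-cong σ≡τ t) (subst-cong σ≡τ u)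

σ₀ : ∀ {n} → Term n → Sub (suc n) n
σ₀ v zero    = v
σ₀ v (suc i) = var i

[]₀-≡-subst-σ₀ : ∀ {n} (t : Term (suc n)) v → t [ v ]₀ ≡ subst (σ₀ v) t
[]₀-≡-subst-σ₀ t v = subst-cong (λ { zero → refl ; (suc i) → refl }) t

σ₀-values : ∀ {n} {v : Term n} → IsValue v → AllValues (σ₀ v)
σ₀-values isv zero    = isv
σ₀-values isv (suc i) = var i

⊩ˢ-σ₀ : ∀ {n} {Δ : Env n} {v P k} → Δ ⊩ v ∶ P # k → (Γ : Env n) → Δ ⊕ Γ ⊩ˢ σ₀ v ∶ P ∷ₑ Γ # k
⊩ˢ-σ₀ {n} {Δ} {v} {P} {k} d Γ = ⊩ˢ envs sizes derivs (⊕-congˡ Δ (Envₘ.sym (renameEnv-id Γ))) k≡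
  where
    envs : Fin (suc n) → Env n
    envs zero    = Δ
    envs (suc i) = single i (Γ i)
    sizes : Fin (suc n) → ℕ
    sizes zero    = k
    sizes (suc i) = 0
    derivs : ∀ i → envs i ⊩ σ₀ v i ∶ (P ∷ₑ Γ) i # sizes i
    derivs zero    = d
    derivs (suc i) = ax i (Γ i)
    k≡ : k ≡ k + ∑ₙ.sum (sizes ∘ suc)
    k≡ = ≡.sym (≡.trans (cong (k +_) (∑ₙ.sum-zero (sizes ∘ suc) (λ _ → refl))) (+-identityʳ k))

⊩-[]₀ : ∀ {n} {Γ : Env (suc n)} {Δ b v Q k j} → IsValue v →
        Γ ⊩ b ∶ Q # k → Δ ⊩ v ∶ Γ zero # j → Δ ⊕ tailEnv Γ ⊩ b [ v ]₀ ∶ Q # k + j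
⊩-[]₀ {Γ = Γ} {b = b} {v} isv d e =
  ≡.subst (λ s → _ ⊩ s ∶ _ # _) (≡.sym ([]₀-≡-subst-σ₀ b v))
    (⊩-subst (σ₀-values isv) d (⊩ˢ-conv (λ { zero → ≃-refl ; (suc i) → ≃-refl }) (⊩ˢ-σ₀ e (tailEnv Γ))))

-- Subject reduction

⊩-subject-reduction : ∀ {n} {Γ : Env n} {t t′ Q k} → Γ ⊩ t ∶ Q # k → t ⟶ t′ →
                      ∃[ k′ ] k ≡ suc k′ × Γ ⊩ t′ ∶ Q # k′
⊩-subject-reduction d (root isv) with ⊩-β-inv d
... | β-inv {Γ′} {Δ} body arg Γ≈ k≡ =
  _ , k≡ , conv (⊩-[]₀ isv body arg) (Envₘ.trans Γ≈ (Envₘ.comm (tailEnv Γ′) Δ)) ≃-refl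
⊩-subject-reduction d (lamL b⟶) with ⊩-β-inv d
... | β-inv {Γ′} {Δ} {k₂ = k₂} body arg Γ≈ k≡ with ⊩-subject-reduction body b⟶
... | k₁ , refl , body′ =
  suc (k₁ + k₂) , k≡ ,
  conv (resize (cong suc (cong (_+ k₂) (+-identityʳ k₁))) (app (lam (body′ ∷ [])) arg ≃-refl))
       (Envₘ.trans Γ≈ (⊕-congʳ Δ (Envₘ.sym (Envₘ.identityʳ (tailEnv Γ′))))) ≃-refl
⊩-subject-reduction d (appL t⟶) with ⊩-·-inv d
... | ·-inv {k₂ = k₂} f a Γ≈ k≡ with ⊩-subject-reduction f t⟶
... | k₁ , refl , f′ = suc (k₁ + k₂) , k≡ , conv (app f′ a ≃-refl) Γ≈ ≃-refl
⊩-subject-reduction d (appR u⟶) with ⊩-·-inv d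
... | ·-inv {k₁ = k₁} f a Γ≈ k≡ with ⊩-subject-reduction a u⟶
... | k₂ , refl , a′ =
  suc (k₁ + k₂) , ≡.trans k≡ (cong suc (+-suc k₁ k₂)) , conv (app f a′ ≃-refl) Γ≈ ≃-refl

closed-normal⇒value : (s : Term 0) → Normal s → IsValue s
closed-normal⇒value (ƛ b)   _  = ƛ b
closed-normal⇒value (t · u) nf
  with closed-normal⇒value t (λ _ t⟶ → nf _ (appL t⟶)) | closed-normal⇒value u (λ _ u⟶ → nf _ (appR u⟶))
... | ƛ b | v = ⊥-elim (nf _ (root v))

reduction-length≡size : ∀ {Γ : Env 0} {t s k m} → Γ ⊩ t ∶ 𝟎 # m → t ⟶[ k ] s → Normal s → k ≡ m
reduction-length≡size d done nf = ≡.sym (proj₂ (⊩-value-𝟎 (closed-normal⇒value _ nf) d))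
reduction-length≡size d (step t⟶ t⟶*s) nf with ⊩-subject-reduction d t⟶
... | _ , refl , d′ = cong suc (reduction-length≡size d′ t⟶*s nf)

-- Normalisability is implied by the given reduction sequence.
mainTheorem8 : (t : Term 0) → Normalizable t →
               (Γ : Env 0) (π : Γ ⊢ t ∶ 𝟎) →
               (s : Term 0) (k : ℕ) → t ⟶[ k ] s → Normal s →
               k ≡ size π
mainTheorem8 t _ Γ π s k t⟶*s s-normal = reduction-length≡size (⊢⇒⊩ π) t⟶*s s-normal
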